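{- Let $k>1$, $A=\mathbb{Z}_2^k$, and let $T$ be a caterpillar with spine path $s_1s_2s_3$ and $|V(T)|=2^k$, where $X,Y,Z$ are the sets of leaves attached to $s_1,s_2,s_3$ respectively. Then $T$ is $A$-rainbow if and only if $|X|$ and $|Z|$ are even and $|Y|$ is odd.
   Context: For an Abelian group $A$ and a tree $T$ with $|V(T)|=|A|$, a labeling $f\colon V(T)\to A$ induces the edge labeling $uv\mapsto f(u)+f(v)$. $f$ is an $A$-rainbow labeling if $f$ is a bijection and all edges receive distinct labels; $T$ is $A$-rainbow if it admits such a labeling. -}

module Defs where

open import Data.Bool using (Bool; _xor_)
open import Data.Nat using (ℕ; suc)
open import Data.Nat.Divisibility using (_∣_)
open import Data.Fin using (Fin)
open import Data.Vec using (Vec; zipWith)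
open import Data.List using (List; map; _∷_; []; _++_)
open import Data.List.Relation.Unary.Unique.Propositional using (Unique)
open import Data.Product using (_×_; _,_; Σ)
open import Data.Sum using (_⊎_; inj₁; inj₂)
open import Function.Definitions using (Bijective)
open import Relation.Binary.PropositionalEquality using (_≡_)

Z2^ : ℕ → Set
Z2^ k = Vec Bool k

_⊕_ : ∀ {k} → Z2^ k → Z2^ k → Z2^ k
_⊕_ = zipWith _xor_

-- A (simple) graph given by a vertex type and its list of edges
-- (each edge listed once, as an unordered pair written as an ordered pair).
record Graph : Set₁ where
  field
    V     : Set
    edges : List (V × V)
open Graph public

edgeLabels : ∀ {k} (G : Graph) → (V G → Z2^ k) → List (Z2^ k)
edgeLabels G f = map (λ e → f (Data.Product.proj₁ e) ⊕ f (Data.Product.proj₂ e)) (edges G)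

IsRainbowLabeling : ∀ k (G : Graph) → (V G → Z2^ k) → Set
IsRainbowLabeling k G f = Bijective _≡_ _≡_ f × Unique (edgeLabels G f)

Rainbow : ℕ → Graph → Set
Rainbow k G = Σ (V G → Z2^ k) (IsRainbowLabeling k G)

-- The caterpillar with spine path s₁ s₂ s₃ and leaf sets X, Y, Z
-- (|X| = a, |Y| = b, |Z| = c) attached to s₁, s₂, s₃ respectively.
-- Vertices: spine Fin 3 (s₁ = 0, s₂ = 1, s₃ = 2), then X, Y, Z.
CatV : ℕ → ℕ → ℕ → Set
CatV a b c = Fin 3 ⊎ (Fin a ⊎ (Fin b ⊎ Fin c))

caterpillar : ℕ → ℕ → ℕ → Graph
caterpillar a b c = record
  { V = CatV a b c
  ; edges = (s 0F , s 1F) ∷ (s 1F , s 2F) ∷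
            (map (λ x → (s 0F , inj₂ (inj₁ x))) (Data.List.allFin a)
            ++ map (λ y → (s 1F , inj₂ (inj₂ (inj₁ y)))) (Data.List.allFin b)
            ++ map (λ z → (s 2F , inj₂ (inj₂ (inj₂ z)))) (Data.List.allFin c))
  }
  where
    s : Fin 3 → CatV a b c
    s = inj₁
    0F 1F 2F : Fin 3
    0F = Fin.zero
    1F = Fin.suc Fin.zero
    2F = Fin.suc (Fin.suc Fin.zero)

Even Odd : ℕ → Set
Even n = 2 ∣ n
Odd n = 2 ∣ suc n

-- Root the caterpillar at s₁, so that every edge is (parent v , v) for a non-root vertex v.
--
-- A rainbow labelling f is a bijection onto Z₂ᵏ, and its 2ᵏ − 1 edge labels are
-- distinct and non-zero; so the vertex labels, and the edge labels together with 0, both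
-- enumerate Z₂ᵏ, whose sum vanishes for k ≥ 2. Hence Σᵥ f(parent v) = Σₑ label e + Σᵥ f v = 0.
-- Counting parents, this sum is |X| f(s₁) + (|Y| + 1) f(s₂) + |Z| f(s₃); as the three spine
-- labels are distinct and |X| + (|Y| + 1) + |Z| = 2ᵏ − 2 is even, all three coefficients are even.
--
-- Write Z₂ᵏ = Z₂² × Z₂ᵏ⁻². The spine and one leaf of s₂ fill the coset Z₂² × 0,
-- with f(s₂) = 0. The other leaves come in pairs hanging on the same spine vertex, and two pairs
-- fill each remaining coset. A leaf on sᵢ has edge label f(leaf) + f(sᵢ), which stays in its coset;
-- for each of the nine combinations of hubs of two pairs there is a placement inside Z₂² on which
-- both the vertex and the edge labels are injective. By counting, an injective labelling with
-- injective edge labels is rainbow.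
module Submission where

open import Defs
open import Algebra.Bundles using (CommutativeMonoid)
open import Algebra.Core using (Op₂)
open import Algebra.Structures using (IsCommutativeMonoid)
open import Data.Bool using (Bool; true; false)
import Data.Bool as Bool
open import Data.Bool.Properties using (xor-assoc; xor-comm; xor-identityˡ; xor-identityʳ; xor-same)
open import Data.Empty using (⊥; ⊥-elim)
open import Data.Fin using (Fin; zero; suc; toℕ; _↑ˡ_; _↑ʳ_; splitAt; cast; combine; remQuot; quotient; remainder)
import Data.Fin.Properties as Fin
open import Data.List using (List; []; _∷_; _++_; [_]; length; foldr; map; allFin)
open import Data.List.Membership.Propositional using (_∈_)
open import Data.List.Membership.Propositional.Properties using (∈-∃++; ∈-map⁺; ∈-map⁻; ∈-++⁺ˡ; ∈-++⁺ʳ)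
open import Data.List.Properties using (length-++; length-map; length-tabulate; map-++; map-∘; map-cong)
open import Data.List.Relation.Binary.Permutation.Propositional using (_↭_; ↭-refl; ↭-sym; ↭-trans; ↭-prep; ↭⇒↭ₛ)
open import Data.List.Relation.Binary.Permutation.Propositional.Properties using (shift; ∈-resp-↭; ↭-length)
import Data.List.Relation.Binary.Permutation.Setoid.Properties as Permutation
open import Data.List.Relation.Binary.Subset.Propositional using (_⊆_)
import Data.List.Relation.Unary.All as All
import Data.List.Relation.Unary.All.Properties as All
open import Data.List.Relation.Unary.AllPairs using (_∷_)
open import Data.List.Relation.Unary.Any using (here; there)
open import Data.List.Relation.Unary.Unique.Propositional using (Unique)
import Data.List.Relation.Unary.Unique.Propositional.Properties as Unique
open import Data.Nat using (ℕ; zero; suc; _+_; _*_; _^_; _≤_; _<_; s≤s⁻¹; parity)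
open import Data.Nat.Divisibility using (_∣_; divides; ∣m+n∣m⇒∣n; ∣-refl)
open import Data.Nat.Properties using (≤-reflexive; +-assoc; +-suc; +-identityʳ; *-comm; suc-injective; *-cancelʳ-≡; +-cancelˡ-≡)
open import Data.Nat.Tactic.RingSolver using (solve-∀)
open import Data.Parity.Base as ℙ using (Parity; 0ℙ; 1ℙ)
open import Data.Parity.Properties using (+-homo-+)
open import Data.Product using (_×_; _,_; proj₁; proj₂; map₂; uncurry)
import Data.Product.Properties as Product
open import Data.Sum using (_⊎_; inj₁; inj₂; [_,_]′)
import Data.Sum as Sum
open import Data.Sum.Properties using (inj₁-injective; inj₂-injective)
open import Data.Vec using ([]; _∷_; replicate) renaming (_++_ to _++ᵥ_)
import Data.Vec.Properties as Vec
open import Function using (_∘_; id; const; flip)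
open import Function.Bundles using (_⇔_; mk⇔)
open import Function.Definitions using (Injective; Surjective; StrictlyInverseʳ)
open import Relation.Binary.Definitions using (DecidableEquality)
open import Relation.Binary.PropositionalEquality
  using (_≡_; _≢_; refl; sym; trans; cong; cong₂; subst; setoid; isEquivalence; module ≡-Reasoning)
open import Relation.Nullary.Decidable using (Dec; map′; _×-dec_; _→-dec_; from-yes)

unique∧⊆∧≤⇒↭ : ∀ {A : Set} {xs ys : List A} →
  Unique xs → xs ⊆ ys → length ys ≤ length xs → xs ↭ ys
unique∧⊆∧≤⇒↭ {xs = []} {[]} _ _ _ = ↭-refl
unique∧⊆∧≤⇒↭ {xs = x ∷ xs} (x∉xs ∷ !xs) xs⊆ys ∣ys∣≤ with ∈-∃++ (xs⊆ys (here refl))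
... | us , vs , refl =
  ↭-trans (↭-prep x (unique∧⊆∧≤⇒↭ !xs xs⊆us++vs ∣us++vs∣≤)) (↭-sym (shift x us vs))
  where
  xs⊆us++vs : xs ⊆ us ++ vs
  xs⊆us++vs z∈xs with ∈-resp-↭ (shift x us vs) (xs⊆ys (there z∈xs))
  ... | here refl      = ⊥-elim (All.lookup x∉xs z∈xs refl)
  ... | there z∈us++vs = z∈us++vs
  ∣us++vs∣≤ : length (us ++ vs) ≤ length xs
  ∣us++vs∣≤ = s≤s⁻¹ (subst (_≤ suc (length xs)) (↭-length (shift x us vs)) ∣ys∣≤)

module _ {A B : Set} where

  _++⊎_ : List A → List B → List (A ⊎ B)
  xs ++⊎ ys = map inj₁ xs ++ map inj₂ ys

  ++⊎-unique : ∀ {xs ys} → Unique xs → Unique ys → Unique (xs ++⊎ ys)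
  ++⊎-unique !xs !ys = Unique.++⁺ (Unique.map⁺ inj₁-injective !xs) (Unique.map⁺ inj₂-injective !ys)
    λ (p , q) → inj₁≢inj₂ (proj₂ (proj₂ (∈-map⁻ inj₁ p))) (proj₂ (proj₂ (∈-map⁻ inj₂ q)))
    where
    inj₁≢inj₂ : ∀ {z : A ⊎ B} {x y} → z ≡ inj₁ x → z ≡ inj₂ y → ⊥
    inj₁≢inj₂ refl ()

  length-++⊎ : ∀ xs ys → length (xs ++⊎ ys) ≡ length xs + length ys
  length-++⊎ xs ys =
    trans (length-++ (map inj₁ xs)) (cong₂ _+_ (length-map inj₁ xs) (length-map inj₂ ys))

  map-++⊎ : ∀ {C : Set} (h : A ⊎ B → C) xs ys →
    map h (xs ++⊎ ys) ≡ map (h ∘ inj₁) xs ++ map (h ∘ inj₂) ys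
  map-++⊎ h xs ys = trans (map-++ h (map inj₁ xs) _) (sym (cong₂ _++_ (map-∘ xs) (map-∘ ys)))

length-allFin : ∀ n → length (allFin n) ≡ n
length-allFin n = length-tabulate {n = n} id

strictlyInverseʳ⇒injective : ∀ {A B : Set} {f : A → B} (g : B → A) →
  StrictlyInverseʳ _≡_ f g → Injective _≡_ _≡_ f
strictlyInverseʳ⇒injective g g∘f≡id {x} {y} fx≡fy =
  trans (sym (g∘f≡id x)) (trans (cong g fx≡fy) (g∘f≡id y))

remQuot-injective : ∀ {m} n → Injective _≡_ _≡_ (remQuot {m} n)
remQuot-injective {m} n = strictlyInverseʳ⇒injective (uncurry combine) (Fin.combine-remQuot {m} n)

injective? : ∀ {m n} {B : Set} → DecidableEquality B → (g : Fin m × Fin n → B) →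
  Dec (Injective _≡_ _≡_ g)
injective? _≟_ g = map′ (λ inj {x} {y} → inj x y) (λ inj x y → inj)
  (all²? λ x → all²? λ y → (g x ≟ g y) →-dec Product.≡-dec Fin._≟_ Fin._≟_ x y)
  where
  all²? : ∀ {m n} {P : Fin m × Fin n → Set} → (∀ x → Dec (P x)) → Dec (∀ x → P x)
  all²? P? = map′ (λ all (i , j) → all i j) (λ all i j → all (i , j))
    (Fin.all? λ i → Fin.all? λ j → P? (i , j))

module CommutativeMonoidSums {A : Set} {_∙_ : Op₂ A} {ε : A}
  (isCommutativeMonoid : IsCommutativeMonoid _≡_ _∙_ ε) where

  private
    M : CommutativeMonoid _ _
    M = record { isCommutativeMonoid = isCommutativeMonoid }
  open CommutativeMonoid M using (identityˡ; assoc; rawMonoid; commutativeSemigroup)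
  open import Algebra.Properties.CommutativeSemigroup commutativeSemigroup using (interchange)
  open import Algebra.Properties.CommutativeSemigroup commutativeSemigroup public using (x∙yz≈y∙xz)
  open import Algebra.Definitions.RawMonoid rawMonoid public
    using () renaming (_×_ to infixr 25 _·_)

  sum : List A → A
  sum = foldr _∙_ ε

  sum-↭ : ∀ {xs ys} → xs ↭ ys → sum xs ≡ sum ys
  sum-↭ xs↭ys = Permutation.foldr-commMonoid (setoid A) isCommutativeMonoid (↭⇒↭ₛ xs↭ys)

  sum-++ : ∀ xs ys → sum (xs ++ ys) ≡ sum xs ∙ sum ys
  sum-++ []       ys = sym (identityˡ (sum ys))
  sum-++ (x ∷ xs) ys = trans (cong (x ∙_) (sum-++ xs ys)) (sym (assoc x (sum xs) (sum ys)))

  sum-map-∙ : ∀ {B : Set} (g h : B → A) xs →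
    sum (map (λ x → g x ∙ h x) xs) ≡ sum (map g xs) ∙ sum (map h xs)
  sum-map-∙ g h []       = sym (identityˡ ε)
  sum-map-∙ g h (x ∷ xs) =
    trans (cong ((g x ∙ h x) ∙_) (sum-map-∙ g h xs)) (interchange (g x) (h x) _ _)

  sum-map-const : ∀ {B : Set} (a : A) (xs : List B) → sum (map (λ _ → a) xs) ≡ length xs · a
  sum-map-const a []       = refl
  sum-map-const a (x ∷ xs) = cong (a ∙_) (sum-map-const a xs)

0v : ∀ {k} → Z2^ k
0v = replicate _ false

module _ {k : ℕ} where

  ⊕-assoc : (u v w : Z2^ k) → (u ⊕ v) ⊕ w ≡ u ⊕ (v ⊕ w)
  ⊕-assoc = Vec.zipWith-assoc xor-assoc

  ⊕-comm : (u v : Z2^ k) → u ⊕ v ≡ v ⊕ u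
  ⊕-comm = Vec.zipWith-comm xor-comm

  ⊕-identityˡ : (v : Z2^ k) → 0v ⊕ v ≡ v
  ⊕-identityˡ = Vec.zipWith-identityˡ xor-identityˡ

  ⊕-identityʳ : (v : Z2^ k) → v ⊕ 0v ≡ v
  ⊕-identityʳ = Vec.zipWith-identityʳ xor-identityʳ

  ⊕-isCommutativeMonoid : IsCommutativeMonoid _≡_ _⊕_ 0v
  ⊕-isCommutativeMonoid = record
    { isMonoid = record
      { isSemigroup = record
        { isMagma = record { isEquivalence = isEquivalence ; ∙-cong = cong₂ _⊕_ }
        ; assoc = ⊕-assoc }
      ; identity = ⊕-identityˡ , ⊕-identityʳ }
    ; comm = ⊕-comm }

  open CommutativeMonoidSums ⊕-isCommutativeMonoid public

⊕-self : ∀ {k} (v : Z2^ k) → v ⊕ v ≡ 0v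
⊕-self []      = refl
⊕-self (x ∷ v) = cong₂ _∷_ (xor-same x) (⊕-self v)

⊕-cancel : ∀ {k} {u v : Z2^ k} → u ⊕ v ≡ 0v → u ≡ v
⊕-cancel {u = u} {v} u⊕v≡0 = begin
  u            ≡⟨ sym (⊕-identityʳ u) ⟩
  u ⊕ 0v       ≡⟨ cong (u ⊕_) (sym (⊕-self v)) ⟩
  u ⊕ (v ⊕ v)  ≡⟨ sym (⊕-assoc u v v) ⟩
  (u ⊕ v) ⊕ v  ≡⟨ cong (_⊕ v) u⊕v≡0 ⟩
  0v ⊕ v       ≡⟨ ⊕-identityˡ v ⟩
  v            ∎
  where open ≡-Reasoning

infixr 25 _·ℙ_

_·ℙ_ : ∀ {k} → Parity → Z2^ k → Z2^ k
0ℙ ·ℙ v = 0v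
1ℙ ·ℙ v = v

·-parity : ∀ {k} n (v : Z2^ k) → n · v ≡ parity n ·ℙ v
·-parity zero          v = refl
·-parity (suc zero)    v = ⊕-identityʳ v
·-parity (suc (suc n)) v = begin
  v ⊕ (v ⊕ n · v)  ≡⟨ sym (⊕-assoc v v (n · v)) ⟩
  (v ⊕ v) ⊕ n · v  ≡⟨ cong (_⊕ n · v) (⊕-self v) ⟩
  0v ⊕ n · v       ≡⟨ ⊕-identityˡ (n · v) ⟩
  n · v            ≡⟨ ·-parity n v ⟩
  parity n ·ℙ v    ∎
  where open ≡-Reasoning

even⇒parity≡0ℙ : ∀ {n} → 2 ∣ n → parity n ≡ 0ℙ
even⇒parity≡0ℙ (divides zero    refl) = refl
even⇒parity≡0ℙ (divides (suc q) refl) = even⇒parity≡0ℙ (divides q refl)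

parity≡0ℙ⇒even : ∀ n → parity n ≡ 0ℙ → 2 ∣ n
parity≡0ℙ⇒even zero          _ = divides zero refl
parity≡0ℙ⇒even (suc (suc n)) p with parity≡0ℙ⇒even n p
... | divides q refl = divides (suc q) refl

even·≡0v : ∀ {k n} (v : Z2^ k) → 2 ∣ n → n · v ≡ 0v
even·≡0v {n = n} v 2∣n = trans (·-parity n v) (cong (_·ℙ v) (even⇒parity≡0ℙ 2∣n))

parities-of-relation : ∀ {k} {A B C : Z2^ k} (α β γ : Parity) → A ≢ B → B ≢ C → A ≢ C →
  α ·ℙ A ⊕ (β ·ℙ B ⊕ γ ·ℙ C) ≡ 0v → α ℙ.+ β ℙ.+ γ ≡ 0ℙ →
  α ≡ 0ℙ × β ≡ 0ℙ × γ ≡ 0ℙ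
parities-of-relation 0ℙ 0ℙ 0ℙ _   _   _   _ _ = refl , refl , refl
parities-of-relation 1ℙ 1ℙ 0ℙ A≢B _   _   r _ =
  ⊥-elim (A≢B (⊕-cancel (trans (cong (_ ⊕_) (sym (⊕-identityʳ _))) r)))
parities-of-relation 1ℙ 0ℙ 1ℙ _   _   A≢C r _ =
  ⊥-elim (A≢C (⊕-cancel (trans (cong (_ ⊕_) (sym (⊕-identityˡ _))) r)))
parities-of-relation 0ℙ 1ℙ 1ℙ _   B≢C _   r _ =
  ⊥-elim (B≢C (⊕-cancel (trans (sym (⊕-identityˡ _)) r)))
parities-of-relation 0ℙ 0ℙ 1ℙ _ _ _ _ ()
parities-of-relation 0ℙ 1ℙ 0ℙ _ _ _ _ ()
parities-of-relation 1ℙ 0ℙ 0ℙ _ _ _ _ ()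
parities-of-relation 1ℙ 1ℙ 1ℙ _ _ _ _ ()

even-coefficients : ∀ {k} {A B C : Z2^ k} (a b c : ℕ) → A ≢ B → B ≢ C → A ≢ C →
  a · A ⊕ (b · B ⊕ c · C) ≡ 0v → 2 ∣ a + b + c → 2 ∣ a × 2 ∣ b × 2 ∣ c
even-coefficients {A = A} {B} {C} a b c A≢B B≢C A≢C r 2∣a+b+c
  with parities-of-relation (parity a) (parity b) (parity c) A≢B B≢C A≢C
         (trans (sym (cong₂ _⊕_ (·-parity a A) (cong₂ _⊕_ (·-parity b B) (·-parity c C)))) r)
         (trans (sym (trans (+-homo-+ (a + b) c) (cong (ℙ._+ parity c) (+-homo-+ a b))))
                (even⇒parity≡0ℙ 2∣a+b+c))
... | pa , pb , pc = parity≡0ℙ⇒even a pa , parity≡0ℙ⇒even b pb , parity≡0ℙ⇒even c pc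

allVecs : ∀ k → List (Z2^ k)
allVecs zero    = [ [] ]
allVecs (suc k) = map (false ∷_) (allVecs k) ++ map (true ∷_) (allVecs k)

∈-allVecs : ∀ {k} (v : Z2^ k) → v ∈ allVecs k
∈-allVecs []          = here refl
∈-allVecs (false ∷ v) = ∈-++⁺ˡ (∈-map⁺ (false ∷_) (∈-allVecs v))
∈-allVecs (true ∷ v)  = ∈-++⁺ʳ _ (∈-map⁺ (true ∷_) (∈-allVecs v))

length-allVecs : ∀ k → length (allVecs k) ≡ 2 ^ k
length-allVecs zero    = refl
length-allVecs (suc k) = begin
  length (map (false ∷_) vs ++ map (true ∷_) vs)          ≡⟨ length-++ (map (false ∷_) vs) ⟩
  length (map (false ∷_) vs) + length (map (true ∷_) vs)  ≡⟨ cong₂ _+_ (length-map _ vs) (length-map _ vs) ⟩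
  length vs + length vs                                    ≡⟨ cong (λ n → n + n) (length-allVecs k) ⟩
  2 ^ k + 2 ^ k                                            ≡⟨ cong (2 ^ k +_) (sym (+-identityʳ (2 ^ k))) ⟩
  2 ^ suc k                                                ∎
  where
  open ≡-Reasoning
  vs : List (Z2^ k)
  vs = allVecs k

sum-allVecs : ∀ k → sum (allVecs (suc (suc k))) ≡ 0v
sum-allVecs k = begin
  sum (map (false ∷_) vs ++ map (true ∷_) vs)  ≡⟨ sum-++ (map (false ∷_) vs) _ ⟩
  S ⊕ sum (map (true ∷_) vs)                   ≡⟨ cong (λ l → S ⊕ sum l) (map-cong (λ v → cong (true ∷_) (sym (⊕-identityˡ v))) vs) ⟩
  S ⊕ sum (map (λ v → e ⊕ (false ∷ v)) vs)     ≡⟨ cong (S ⊕_) (sum-map-∙ (λ _ → e) (false ∷_) vs) ⟩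
  S ⊕ (sum (map (λ _ → e) vs) ⊕ S)             ≡⟨ cong (λ x → S ⊕ (x ⊕ S)) (sum-map-const e vs) ⟩
  S ⊕ (length vs · e ⊕ S)                      ≡⟨ cong (λ x → S ⊕ (x ⊕ S)) (even·≡0v e 2∣∣vs∣) ⟩
  S ⊕ (0v ⊕ S)                                 ≡⟨ cong (S ⊕_) (⊕-identityˡ S) ⟩
  S ⊕ S                                        ≡⟨ ⊕-self S ⟩
  0v                                           ∎
  where
  open ≡-Reasoning
  vs : List (Z2^ (suc k))
  vs = allVecs (suc k)
  S e : Z2^ (suc (suc k))
  S = sum (map (false ∷_) vs)
  e = true ∷ 0v
  2∣∣vs∣ : 2 ∣ length vs
  2∣∣vs∣ = divides (2 ^ k) (trans (length-allVecs (suc k)) (*-comm 2 (2 ^ k)))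

↭-allVecs : ∀ {k} {xs : List (Z2^ k)} → Unique xs → length xs ≡ 2 ^ k → xs ↭ allVecs k
↭-allVecs {k} !xs ∣xs∣≡2^k =
  unique∧⊆∧≤⇒↭ !xs (λ _ → ∈-allVecs _) (≤-reflexive (trans (length-allVecs k) (sym ∣xs∣≡2^k)))

module Caterpillar {a b c : ℕ} where

  spine : Fin 3 → CatV a b c
  spine = inj₁

  -- The root s₁ is its own parent, so its "edge label" f s₁ ⊕ f s₁ is the junk value 0.
  parent : CatV a b c → CatV a b c
  parent (inj₁ zero)             = spine zero
  parent (inj₁ (suc zero))       = spine zero
  parent (inj₁ (suc (suc zero))) = spine (suc zero)
  parent (inj₂ (inj₁ _))         = spine zero
  parent (inj₂ (inj₂ (inj₁ _)))  = spine (suc zero)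
  parent (inj₂ (inj₂ (inj₂ _)))  = spine (suc (suc zero))

  parent-fixed : ∀ v → parent v ≡ v → v ≡ spine zero
  parent-fixed (inj₁ zero)             _  = refl
  parent-fixed (inj₁ (suc zero))       ()
  parent-fixed (inj₁ (suc (suc zero))) ()
  parent-fixed (inj₂ (inj₁ _))         ()
  parent-fixed (inj₂ (inj₂ (inj₁ _)))  ()
  parent-fixed (inj₂ (inj₂ (inj₂ _)))  ()

  leaves : List (CatV a b c)
  leaves = map inj₂ (allFin a ++⊎ (allFin b ++⊎ allFin c))

  children : List (CatV a b c)
  children = spine (suc zero) ∷ spine (suc (suc zero)) ∷ leaves

  vertices : List (CatV a b c)
  vertices = spine zero ∷ children

  vertices-unique : Unique vertices
  vertices-unique = ++⊎-unique (Unique.allFin⁺ 3)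
    (++⊎-unique (Unique.allFin⁺ a) (++⊎-unique (Unique.allFin⁺ b) (Unique.allFin⁺ c)))

  children-unique : Unique children
  children-unique with vertices-unique
  ... | _ ∷ !children = !children

  length-vertices : length vertices ≡ 3 + a + b + c
  length-vertices = cong (3 +_) (begin
    length leaves                                               ≡⟨ length-map inj₂ (allFin a ++⊎ _) ⟩
    length (allFin a ++⊎ (allFin b ++⊎ allFin c))               ≡⟨ length-++⊎ (allFin a) _ ⟩
    length (allFin a) + length (allFin b ++⊎ allFin c)          ≡⟨ cong (length (allFin a) +_) (length-++⊎ (allFin b) _) ⟩
    length (allFin a) + (length (allFin b) + length (allFin c)) ≡⟨ cong₂ _+_ (length-allFin a) (cong₂ _+_ (length-allFin b) (length-allFin c)) ⟩
    a + (b + c)                                                 ≡⟨ sym (+-assoc a b c) ⟩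
    a + b + c                                                   ∎)
    where open ≡-Reasoning

  edges-caterpillar : edges (caterpillar a b c) ≡ map (λ v → parent v , v) children
  edges-caterpillar = cong (λ l → (spine zero , spine (suc zero)) ∷ (spine (suc zero) , spine (suc (suc zero))) ∷ l)
    (sym (begin
      map h (map inj₂ (allFin a ++⊎ (allFin b ++⊎ allFin c)))
        ≡⟨ sym (map-∘ (allFin a ++⊎ _)) ⟩
      map (h ∘ inj₂) (allFin a ++⊎ (allFin b ++⊎ allFin c))
        ≡⟨ map-++⊎ (h ∘ inj₂) (allFin a) _ ⟩
      map (h ∘ inj₂ ∘ inj₁) (allFin a) ++ map (h ∘ inj₂ ∘ inj₂) (allFin b ++⊎ allFin c)
        ≡⟨ cong (map (h ∘ inj₂ ∘ inj₁) (allFin a) ++_) (map-++⊎ (h ∘ inj₂ ∘ inj₂) (allFin b) _) ⟩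
      map (h ∘ inj₂ ∘ inj₁) (allFin a) ++ map (h ∘ inj₂ ∘ inj₂ ∘ inj₁) (allFin b)
                                       ++ map (h ∘ inj₂ ∘ inj₂ ∘ inj₂) (allFin c)
        ∎))
    where
    open ≡-Reasoning
    h : CatV a b c → CatV a b c × CatV a b c
    h v = parent v , v

  edgeLabel : ∀ {k} → (CatV a b c → Z2^ k) → CatV a b c → Z2^ k
  edgeLabel f v = f (parent v) ⊕ f v

  edgeLabels-caterpillar : ∀ {k} (f : CatV a b c → Z2^ k) →
    edgeLabels (caterpillar a b c) f ≡ map (edgeLabel f) children
  edgeLabels-caterpillar f = trans (cong (map _) edges-caterpillar) (sym (map-∘ children))

  sum-parents : ∀ {k} (f : CatV a b c → Z2^ k) →
    let A = f (spine zero) ; B = f (spine (suc zero)) ; C = f (spine (suc (suc zero))) in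
    sum (map (f ∘ parent) vertices) ≡ A ⊕ (A ⊕ (B ⊕ (a · A ⊕ (b · B ⊕ c · C))))
  sum-parents {k} f = cong (λ x → A ⊕ (A ⊕ (B ⊕ x))) (begin
    sum (map (f ∘ parent) leaves)
      ≡⟨ cong sum (sym (map-∘ (allFin a ++⊎ _))) ⟩
    sum (map (f ∘ parent ∘ inj₂) (allFin a ++⊎ (allFin b ++⊎ allFin c)))
      ≡⟨ cong sum (map-++⊎ _ (allFin a) _) ⟩
    sum (map (λ _ → A) (allFin a) ++ map (f ∘ parent ∘ inj₂ ∘ inj₂) (allFin b ++⊎ allFin c))
      ≡⟨ sum-++ (map (λ _ → A) (allFin a)) _ ⟩
    sum (map (λ _ → A) (allFin a)) ⊕ sum (map (f ∘ parent ∘ inj₂ ∘ inj₂) (allFin b ++⊎ allFin c))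
      ≡⟨ cong₂ _⊕_ (sum-const A a) (trans (cong sum (map-++⊎ _ (allFin b) _)) (sum-++ (map (λ _ → B) (allFin b)) _)) ⟩
    a · A ⊕ (sum (map (λ _ → B) (allFin b)) ⊕ sum (map (λ _ → C) (allFin c)))
      ≡⟨ cong (a · A ⊕_) (cong₂ _⊕_ (sum-const B b) (sum-const C c)) ⟩
    a · A ⊕ (b · B ⊕ c · C)
      ∎)
    where
    open ≡-Reasoning
    A B C : Z2^ k
    A = f (spine zero)
    B = f (spine (suc zero))
    C = f (spine (suc (suc zero)))
    sum-const : ∀ v n → sum (map (λ (_ : Fin n) → v) (allFin n)) ≡ n · v
    sum-const v n = trans (sum-map-const v (allFin n)) (cong (_· v) (length-allFin n))

  injective⇒rainbow : ∀ {k} → 3 + a + b + c ≡ 2 ^ k → (f : CatV a b c → Z2^ k) →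
    Injective _≡_ _≡_ f → Injective _≡_ _≡_ (edgeLabel f) → Rainbow k (caterpillar a b c)
  injective⇒rainbow ∣V∣≡2^k f f-inj ε-inj =
    f , (f-inj , surjective) ,
    subst Unique (sym (edgeLabels-caterpillar f)) (Unique.map⁺ ε-inj children-unique)
    where
    surjective : Surjective _≡_ _≡_ f
    surjective w with ∈-map⁻ f (∈-resp-↭ (↭-sym (↭-allVecs (Unique.map⁺ f-inj vertices-unique)
                        (trans (length-map f vertices) (trans length-vertices ∣V∣≡2^k)))) (∈-allVecs w))
    ... | v , _ , refl = v , λ { refl → refl }

-- Necessity

module Necessity {m a b c : ℕ} (∣V∣≡2^k : 3 + a + b + c ≡ 2 ^ suc (suc m))
  (f : CatV a b c → Z2^ (suc (suc m))) (f-inj : Injective _≡_ _≡_ f)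
  (labels-unique : Unique (edgeLabels (caterpillar a b c) f)) where

  open Caterpillar {a} {b} {c}
  open ≡-Reasoning

  A B C : Z2^ (suc (suc m))
  A = f (spine zero)
  B = f (spine (suc zero))
  C = f (spine (suc (suc zero)))

  spine-labels-distinct : ∀ {i j} → spine i ≢ spine j → f (spine i) ≢ f (spine j)
  spine-labels-distinct i≢j = i≢j ∘ f-inj

  sum-enumeration : ∀ {xs} → Unique xs → length xs ≡ 3 + a + b + c → sum xs ≡ 0v
  sum-enumeration !xs ∣xs∣ = trans (sum-↭ (↭-allVecs !xs (trans ∣xs∣ ∣V∣≡2^k))) (sum-allVecs m)

  sum-labels≡0 : sum (map f vertices) ≡ 0v
  sum-labels≡0 = sum-enumeration (Unique.map⁺ f-inj vertices-unique)
                                 (trans (length-map f vertices) length-vertices)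

  root-edgeLabel≢ : ∀ {v} → spine zero ≢ v → edgeLabel f (spine zero) ≢ edgeLabel f v
  root-edgeLabel≢ {v} s₁≢v eq =
    s₁≢v (sym (parent-fixed v (f-inj (⊕-cancel (trans (sym eq) (⊕-self A))))))

  sum-edgeLabels≡0 : sum (map (edgeLabel f) vertices) ≡ 0v
  sum-edgeLabels≡0 with vertices-unique
  ... | s₁∉children ∷ _ = sum-enumeration
    (All.map⁺ (All.map root-edgeLabel≢ s₁∉children) ∷ subst Unique (edgeLabels-caterpillar f) labels-unique)
    (trans (length-map (edgeLabel f) vertices) length-vertices)

  sum-parents≡0 : sum (map (f ∘ parent) vertices) ≡ 0v
  sum-parents≡0 = begin
    sum (map (f ∘ parent) vertices)                         ≡⟨ sym (⊕-identityʳ _) ⟩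
    sum (map (f ∘ parent) vertices) ⊕ 0v                    ≡⟨ cong (sum (map (f ∘ parent) vertices) ⊕_) (sym sum-labels≡0) ⟩
    sum (map (f ∘ parent) vertices) ⊕ sum (map f vertices)  ≡⟨ sym (sum-map-∙ (f ∘ parent) f vertices) ⟩
    sum (map (edgeLabel f) vertices)                        ≡⟨ sum-edgeLabels≡0 ⟩
    0v                                                      ∎

  spine-relation : a · A ⊕ (suc b · B ⊕ c · C) ≡ 0v
  spine-relation = begin
    a · A ⊕ ((B ⊕ b · B) ⊕ c · C)    ≡⟨ cong (a · A ⊕_) (⊕-assoc B (b · B) (c · C)) ⟩
    a · A ⊕ (B ⊕ (b · B ⊕ c · C))    ≡⟨ x∙yz≈y∙xz (a · A) B (b · B ⊕ c · C) ⟩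
    B ⊕ R                            ≡⟨ sym (⊕-identityˡ (B ⊕ R)) ⟩
    0v ⊕ (B ⊕ R)                     ≡⟨ cong (_⊕ (B ⊕ R)) (sym (⊕-self A)) ⟩
    (A ⊕ A) ⊕ (B ⊕ R)                ≡⟨ ⊕-assoc A A (B ⊕ R) ⟩
    A ⊕ (A ⊕ (B ⊕ R))                ≡⟨ sym (sum-parents f) ⟩
    sum (map (f ∘ parent) vertices)  ≡⟨ sum-parents≡0 ⟩
    0v                               ∎
    where
    R : Z2^ (suc (suc m))
    R = a · A ⊕ (b · B ⊕ c · C)

  coefficient-sum-even : 2 ∣ a + suc b + c
  coefficient-sum-even = ∣m+n∣m⇒∣n
    (subst (2 ∣_) (trans (sym ∣V∣≡2^k) (cong (λ x → 2 + (x + c)) (sym (+-suc a b))))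
           (divides (2 ^ suc m) (*-comm 2 (2 ^ suc m))))
    (∣-refl {2})

rainbow⇒parities : ∀ m a b c → 3 + a + b + c ≡ 2 ^ suc (suc m) →
  Rainbow (suc (suc m)) (caterpillar a b c) → Even a × Even c × Odd b
rainbow⇒parities m a b c ∣V∣≡2^k (f , (f-inj , _) , labels-unique)
  with even-coefficients a (suc b) c (spine-labels-distinct λ ()) (spine-labels-distinct λ ())
         (spine-labels-distinct λ ()) spine-relation coefficient-sum-even
  where open Necessity ∣V∣≡2^k f f-inj labels-unique
... | 2∣a , 2∣1+b , 2∣c = 2∣a , 2∣c , 2∣1+b

-- Labels by cosets of Z₂² × 0

mersenne : ℕ → ℕ
mersenne zero    = 0
mersenne (suc m) = suc (mersenne m * 2)

suc-mersenne : ∀ m → suc (mersenne m) ≡ 2 ^ m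
suc-mersenne zero    = refl
suc-mersenne (suc m) = trans (cong (_* 2) (suc-mersenne m)) (*-comm (2 ^ m) 2)

bit : Fin 2 → Bool
bit zero       = false
bit (suc zero) = true

bit-injective : Injective _≡_ _≡_ bit
bit-injective {zero}     {zero}     _  = refl
bit-injective {suc zero} {suc zero} _  = refl
bit-injective {zero}     {suc zero} ()
bit-injective {suc zero} {zero}     ()

-- Indexing by Fin (suc (mersenne m)) rather than Fin (2 ^ m) makes the zero coset `zero`.
bits : ∀ m → Fin (suc (mersenne m)) → Z2^ m
bits zero    _ = []
bits (suc m) i = bit (remainder {suc (mersenne m)} 2 i) ∷ bits m (quotient {suc (mersenne m)} 2 i)

bits-zero : ∀ m → bits m zero ≡ 0v
bits-zero zero    = refl
bits-zero (suc m) = cong (false ∷_) (bits-zero m)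

bits-injective : ∀ m → Injective _≡_ _≡_ (bits m)
bits-injective zero    {zero} {zero} _ = refl
bits-injective (suc m) eq = remQuot-injective {suc (mersenne m)} 2
  (cong₂ _,_ (bits-injective m (Vec.∷-injectiveʳ eq)) (bit-injective (Vec.∷-injectiveˡ eq)))

embed : ∀ m → Z2^ 2 × Fin (suc (mersenne m)) → Z2^ (suc (suc m))
embed m (d , r) = d ++ᵥ bits m r

embed-injective : ∀ m → Injective _≡_ _≡_ (embed m)
embed-injective m {d , r} {d′ , r′} eq =
  cong₂ _,_ (Vec.++-injectiveˡ d d′ eq) (bits-injective m (Vec.++-injectiveʳ d d′ eq))

embed-⊕ : ∀ m d d′ r → embed m (d , zero) ⊕ embed m (d′ , r) ≡ embed m (d ⊕ d′ , r)
embed-⊕ m d d′ r = begin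
  (d ++ᵥ bits m zero) ⊕ (d′ ++ᵥ bits m r)  ≡⟨ Vec.zipWith-++ _ d (bits m zero) d′ (bits m r) ⟩
  (d ⊕ d′) ++ᵥ (bits m zero ⊕ bits m r)   ≡⟨ cong (λ z → (d ⊕ d′) ++ᵥ (z ⊕ bits m r)) (bits-zero m) ⟩
  (d ⊕ d′) ++ᵥ (0v ⊕ bits m r)            ≡⟨ cong ((d ⊕ d′) ++ᵥ_) (⊕-identityˡ (bits m r)) ⟩
  (d ⊕ d′) ++ᵥ bits m r                   ∎
  where open ≡-Reasoning

cosetwise : ∀ {D L : Set} {n} → (D → D) → (L → D × Fin n) → D ⊎ L → D × Fin (suc n)
cosetwise g₀ g = [ (λ d → g₀ d , zero) , map₂ suc ∘ g ]′

cosetwise-injective : ∀ {D L : Set} {n} {g₀ : D → D} {g : L → D × Fin n} →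
  Injective _≡_ _≡_ g₀ → Injective _≡_ _≡_ g → Injective _≡_ _≡_ (cosetwise g₀ g)
cosetwise-injective g₀-inj g-inj {inj₁ d} {inj₁ d′} eq = cong inj₁ (g₀-inj (cong proj₁ eq))
cosetwise-injective g₀-inj g-inj {inj₂ ℓ} {inj₂ ℓ′} eq =
  cong inj₂ (g-inj (cong₂ _,_ (cong proj₁ eq) (Fin.suc-injective (cong proj₂ eq))))
cosetwise-injective g₀-inj g-inj {inj₁ d} {inj₂ ℓ′} eq with cong proj₂ eq
... | ()
cosetwise-injective g₀-inj g-inj {inj₂ ℓ} {inj₁ d′} eq with cong proj₂ eq
... | ()

fibred : ∀ {L J X D : Set} → (J → X → D) → (L → J × X) → L → D × J
fibred φ coord ℓ = φ (proj₁ (coord ℓ)) (proj₂ (coord ℓ)) , proj₁ (coord ℓ)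

fibred-injective : ∀ {L J X D : Set} {φ : J → X → D} {coord : L → J × X} →
  (∀ j → Injective _≡_ _≡_ (φ j)) → Injective _≡_ _≡_ coord → Injective _≡_ _≡_ (fibred φ coord)
fibred-injective {φ = φ} {coord} φ-inj coord-inj {ℓ} {ℓ′} eq = coord-inj (fibre (coord ℓ) (coord ℓ′) eq)
  where
  fibre : ∀ u v → (φ (proj₁ u) (proj₂ u) , proj₁ u) ≡ (φ (proj₁ v) (proj₂ v) , proj₁ v) → u ≡ v
  fibre (j , x) (j′ , y) eq with cong proj₂ eq
  ... | refl = cong (j ,_) (φ-inj j (cong proj₁ eq))

e₁ e₂ : Z2^ 2
e₁ = true ∷ false ∷ []
e₂ = false ∷ true ∷ []

hubDigit : Fin 3 → Z2^ 2
hubDigit zero             = e₁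
hubDigit (suc zero)       = 0v
hubDigit (suc (suc zero)) = e₂

-- The two leaves of a pair differ by `along`. If the hub digit of a pair is 0 or `along`, its
-- edge labels are its own digits; otherwise (two pairs on s₁ or s₃, along = e₁ ⊕ e₂) the two
-- pairs exchange their digit sets.
along across : Fin 3 → Fin 3 → Z2^ 2
along zero             (suc zero)       = e₁
along (suc zero)       zero             = e₁
along (suc (suc zero)) (suc zero)       = e₂
along (suc zero)       (suc (suc zero)) = e₂
along _                _                = e₁ ⊕ e₂
across zero       (suc zero) = e₂
across (suc zero) zero       = e₂
across _          _          = e₁

blockDigit : Fin 3 → Fin 3 → Fin 2 × Fin 2 → Z2^ 2
blockDigit K₀ K₁ (h , e) = toℕ h · across K₀ K₁ ⊕ toℕ e · along K₀ K₁

slot : Fin 3 → Fin 3 → Fin 2 → Fin 3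
slot K₀ K₁ zero       = K₀
slot K₀ K₁ (suc zero) = K₁

blockEdgeDigit : Fin 3 → Fin 3 → Fin 2 × Fin 2 → Z2^ 2
blockEdgeDigit K₀ K₁ (h , e) = hubDigit (slot K₀ K₁ h) ⊕ blockDigit K₀ K₁ (h , e)

block-injective : ∀ K₀ K₁ →
  Injective _≡_ _≡_ (blockDigit K₀ K₁) × Injective _≡_ _≡_ (blockEdgeDigit K₀ K₁)
block-injective = from-yes (Fin.all? λ K₀ → Fin.all? λ K₁ →
  injective? _≟_ (blockDigit K₀ K₁) ×-dec injective? _≟_ (blockEdgeDigit K₀ K₁))
  where
  _≟_ : DecidableEquality (Z2^ 2)
  _≟_ = Vec.≡-dec Bool._≟_

-- s₁, s₂, s₃ and the first leaf of s₂ get digits e₁, 0, e₂, e₁ ⊕ e₂ in the zero coset; their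
-- edge labels are e₁ ⊕ e₁, e₁ ⊕ 0, 0 ⊕ e₂ and 0 ⊕ (e₁ ⊕ e₂).
coreEdgeDigit : Z2^ 2 → Z2^ 2
coreEdgeDigit (true  ∷ false ∷ []) = 0v
coreEdgeDigit (false ∷ false ∷ []) = e₁
coreEdgeDigit d                    = d

coreEdgeDigit-injective : Injective _≡_ _≡_ coreEdgeDigit
coreEdgeDigit-injective = strictlyInverseʳ⇒injective coreEdgeDigit
  λ { (true ∷ false ∷ []) → refl ; (false ∷ false ∷ []) → refl
    ; (false ∷ true ∷ []) → refl ; (true ∷ true ∷ []) → refl }

-- Sufficiency

-- The leaves of s₁, of s₂ (but the first) and of s₃ form p, t and q pairs, numbered
-- consecutively; pairs 2j and 2j + 1 share the coset suc j.
module Construction (m p t q : ℕ) (pairs : p + (t + q) ≡ mersenne m * 2) where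

  Leaf : Set
  Leaf = Fin (p * 2) ⊎ (Fin (t * 2) ⊎ Fin (q * 2))

  hubOf : Leaf → Fin 3
  hubOf (inj₁ _)        = zero
  hubOf (inj₂ (inj₁ _)) = suc zero
  hubOf (inj₂ (inj₂ _)) = suc (suc zero)

  pairHub : Fin (p + (t + q)) → Fin 3
  pairHub i = [ const zero , [ const (suc zero) , const (suc (suc zero)) ]′ ∘ splitAt t ]′ (splitAt p i)

  pairOf : Leaf → Fin (p + (t + q)) × Fin 2
  pairOf (inj₁ x)        = quotient {p} 2 x ↑ˡ (t + q)  , remainder {p} 2 x
  pairOf (inj₂ (inj₁ y)) = p ↑ʳ (quotient {t} 2 y ↑ˡ q) , remainder {t} 2 y
  pairOf (inj₂ (inj₂ z)) = p ↑ʳ (t ↑ʳ quotient {q} 2 z) , remainder {q} 2 z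

  unpair : Fin (p + (t + q)) × Fin 2 → Leaf
  unpair (i , e) = Sum.map (flip combine e) (Sum.map (flip combine e) (flip combine e))
                           (Sum.map₂ (splitAt t) (splitAt p i))

  unpair-pairOf : StrictlyInverseʳ _≡_ pairOf unpair
  unpair-pairOf (inj₁ x)
    rewrite Fin.splitAt-↑ˡ p (quotient {p} 2 x) (t + q) = cong inj₁ (Fin.combine-remQuot {p} 2 x)
  unpair-pairOf (inj₂ (inj₁ y))
    rewrite Fin.splitAt-↑ʳ p (t + q) (quotient {t} 2 y ↑ˡ q) | Fin.splitAt-↑ˡ t (quotient {t} 2 y) q
    = cong (inj₂ ∘ inj₁) (Fin.combine-remQuot {t} 2 y)
  unpair-pairOf (inj₂ (inj₂ z))
    rewrite Fin.splitAt-↑ʳ p (t + q) (t ↑ʳ quotient {q} 2 z) | Fin.splitAt-↑ʳ t q (quotient {q} 2 z)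
    = cong (inj₂ ∘ inj₂) (Fin.combine-remQuot {q} 2 z)

  pairHub-pairOf : ∀ ℓ → pairHub (proj₁ (pairOf ℓ)) ≡ hubOf ℓ
  pairHub-pairOf (inj₁ x)
    rewrite Fin.splitAt-↑ˡ p (quotient {p} 2 x) (t + q) = refl
  pairHub-pairOf (inj₂ (inj₁ y))
    rewrite Fin.splitAt-↑ʳ p (t + q) (quotient {t} 2 y ↑ˡ q) | Fin.splitAt-↑ˡ t (quotient {t} 2 y) q = refl
  pairHub-pairOf (inj₂ (inj₂ z))
    rewrite Fin.splitAt-↑ʳ p (t + q) (t ↑ʳ quotient {q} 2 z) | Fin.splitAt-↑ʳ t q (quotient {q} 2 z) = refl

  pairAt : Fin (mersenne m) → Fin 2 → Fin (p + (t + q))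
  pairAt j h = cast (sym pairs) (combine j h)

  cosetOf : Fin (p + (t + q)) → Fin (mersenne m) × Fin 2
  cosetOf i = remQuot 2 (cast pairs i)

  pairAt-cosetOf : ∀ i → uncurry pairAt (cosetOf i) ≡ i
  pairAt-cosetOf i = trans (cong (cast (sym pairs)) (Fin.combine-remQuot {mersenne m} 2 (cast pairs i)))
                           (Fin.cast-involutive (sym pairs) pairs i)

  coordinates : Leaf → Fin (mersenne m) × (Fin 2 × Fin 2)
  coordinates ℓ = proj₁ (cosetOf (proj₁ (pairOf ℓ))) , proj₂ (cosetOf (proj₁ (pairOf ℓ))) , proj₂ (pairOf ℓ)

  coordinates-injective : Injective _≡_ _≡_ coordinates
  coordinates-injective = strictlyInverseʳ⇒injective (λ (j , h , e) → unpair (pairAt j h , e))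
    λ ℓ → trans (cong (λ i → unpair (i , proj₂ (pairOf ℓ))) (pairAt-cosetOf (proj₁ (pairOf ℓ))))
                (unpair-pairOf ℓ)

  hubAt : Fin (mersenne m) → Fin 2 → Fin 3
  hubAt j h = pairHub (pairAt j h)

  hubAt-coordinates : ∀ ℓ → uncurry hubAt (map₂ proj₁ (coordinates ℓ)) ≡ hubOf ℓ
  hubAt-coordinates ℓ = trans (cong pairHub (pairAt-cosetOf (proj₁ (pairOf ℓ)))) (pairHub-pairOf ℓ)

  slot-hubAt : ∀ j h → slot (hubAt j zero) (hubAt j (suc zero)) h ≡ hubAt j h
  slot-hubAt j zero       = refl
  slot-hubAt j (suc zero) = refl

  leafDigit leafEdgeDigit : Fin (mersenne m) → Fin 2 × Fin 2 → Z2^ 2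
  leafDigit     j = blockDigit     (hubAt j zero) (hubAt j (suc zero))
  leafEdgeDigit j = blockEdgeDigit (hubAt j zero) (hubAt j (suc zero))

  Vertex : Set
  Vertex = CatV (p * 2) (suc (t * 2)) (q * 2)

  classify : Vertex → Z2^ 2 ⊎ Leaf
  classify (inj₁ i)                     = inj₁ (hubDigit i)
  classify (inj₂ (inj₁ x))              = inj₂ (inj₁ x)
  classify (inj₂ (inj₂ (inj₁ zero)))    = inj₁ (e₁ ⊕ e₂)
  classify (inj₂ (inj₂ (inj₁ (suc y)))) = inj₂ (inj₂ (inj₁ y))
  classify (inj₂ (inj₂ (inj₂ z)))       = inj₂ (inj₂ (inj₂ z))

  declassify : Z2^ 2 ⊎ Leaf → Vertex
  declassify (inj₁ (true  ∷ false ∷ [])) = inj₁ zero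
  declassify (inj₁ (false ∷ false ∷ [])) = inj₁ (suc zero)
  declassify (inj₁ (false ∷ true  ∷ [])) = inj₁ (suc (suc zero))
  declassify (inj₁ (true  ∷ true  ∷ [])) = inj₂ (inj₂ (inj₁ zero))
  declassify (inj₂ (inj₁ x))             = inj₂ (inj₁ x)
  declassify (inj₂ (inj₂ (inj₁ y)))      = inj₂ (inj₂ (inj₁ (suc y)))
  declassify (inj₂ (inj₂ (inj₂ z)))      = inj₂ (inj₂ (inj₂ z))

  classify-injective : Injective _≡_ _≡_ classify
  classify-injective = strictlyInverseʳ⇒injective declassify λ
    { (inj₁ zero) → refl ; (inj₁ (suc zero)) → refl ; (inj₁ (suc (suc zero))) → refl
    ; (inj₂ (inj₁ _)) → refl ; (inj₂ (inj₂ (inj₁ zero))) → refl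
    ; (inj₂ (inj₂ (inj₁ (suc _)))) → refl ; (inj₂ (inj₂ (inj₂ _))) → refl }

  label : Vertex → Z2^ (suc (suc m))
  label = embed m ∘ cosetwise id (fibred leafDigit coordinates) ∘ classify

  edgePosition : Vertex → Z2^ 2 × Fin (suc (mersenne m))
  edgePosition = cosetwise coreEdgeDigit (fibred leafEdgeDigit coordinates) ∘ classify

  open Caterpillar {p * 2} {suc (t * 2)} {q * 2} using (edgeLabel)

  edgeLabel-leaf : ∀ ℓ →
    embed m (hubDigit (hubOf ℓ) , zero) ⊕ embed m (map₂ suc (fibred leafDigit coordinates ℓ))
      ≡ embed m (map₂ suc (fibred leafEdgeDigit coordinates ℓ))
  edgeLabel-leaf ℓ = trans (embed-⊕ m _ _ _)
    (cong (λ K → embed m (hubDigit K ⊕ leafDigit j x , suc j))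
          (sym (trans (slot-hubAt j (proj₁ x)) (hubAt-coordinates ℓ))))
    where
    j : Fin (mersenne m)
    j = proj₁ (coordinates ℓ)
    x : Fin 2 × Fin 2
    x = proj₂ (coordinates ℓ)

  edgeLabel-embed : ∀ v → edgeLabel label v ≡ embed m (edgePosition v)
  edgeLabel-embed (inj₁ zero)                  = embed-⊕ m e₁ e₁ zero
  edgeLabel-embed (inj₁ (suc zero))            = embed-⊕ m e₁ 0v zero
  edgeLabel-embed (inj₁ (suc (suc zero)))      = embed-⊕ m 0v e₂ zero
  edgeLabel-embed (inj₂ (inj₂ (inj₁ zero)))    = embed-⊕ m 0v (e₁ ⊕ e₂) zero
  edgeLabel-embed (inj₂ (inj₁ x))              = edgeLabel-leaf (inj₁ x)
  edgeLabel-embed (inj₂ (inj₂ (inj₁ (suc y)))) = edgeLabel-leaf (inj₂ (inj₁ y))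
  edgeLabel-embed (inj₂ (inj₂ (inj₂ z)))       = edgeLabel-leaf (inj₂ (inj₂ z))

  label-injective : Injective _≡_ _≡_ label
  label-injective eq = classify-injective
    (cosetwise-injective id
       (fibred-injective (λ j → proj₁ (block-injective (hubAt j zero) (hubAt j (suc zero)))) coordinates-injective)
       (embed-injective m eq))

  edgeLabel-injective : Injective _≡_ _≡_ (edgeLabel label)
  edgeLabel-injective {v} {w} eq = classify-injective
    (cosetwise-injective coreEdgeDigit-injective
       (fibred-injective (λ j → proj₂ (block-injective (hubAt j zero) (hubAt j (suc zero)))) coordinates-injective)
       (embed-injective m (trans (sym (edgeLabel-embed v)) (trans eq (edgeLabel-embed w)))))

pair-count : ∀ m p t q → 3 + p * 2 + suc (t * 2) + q * 2 ≡ 2 ^ suc (suc m) →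
  p + (t + q) ≡ mersenne m * 2
pair-count m p t q ∣V∣≡2^k = *-cancelʳ-≡ _ _ 2 (+-cancelˡ-≡ 4 _ _ (begin
  4 + (p + (t + q)) * 2            ≡⟨ regroup p t q ⟩
  3 + p * 2 + suc (t * 2) + q * 2  ≡⟨ ∣V∣≡2^k ⟩
  2 * (2 * 2 ^ m)                  ≡⟨ cong (λ x → 2 * (2 * x)) (sym (suc-mersenne m)) ⟩
  2 * (2 * suc (mersenne m))       ≡⟨ quadruple (mersenne m) ⟩
  4 + mersenne m * 2 * 2           ∎))
  where
  open ≡-Reasoning
  regroup : ∀ p t q → 4 + (p + (t + q)) * 2 ≡ 3 + p * 2 + suc (t * 2) + q * 2
  regroup = solve-∀
  quadruple : ∀ n → 2 * (2 * suc n) ≡ 4 + n * 2 * 2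
  quadruple = solve-∀

parities⇒rainbow : ∀ m a b c → 3 + a + b + c ≡ 2 ^ suc (suc m) → Even a × Even c × Odd b →
  Rainbow (suc (suc m)) (caterpillar a b c)
parities⇒rainbow m _ _ _ ∣V∣≡2^k (divides p refl , divides q refl , divides (suc t) 1+b≡)
  with refl ← suc-injective 1+b≡ =
  Caterpillar.injective⇒rainbow ∣V∣≡2^k label label-injective edgeLabel-injective
  where open Construction m p t q (pair-count m p t q ∣V∣≡2^k)

theorem7 : (k a b c : ℕ) → 1 < k → 3 + a + b + c ≡ 2 ^ k →
    Rainbow k (caterpillar a b c) ⇔ (Even a × Even c × Odd b)
theorem7 (suc (suc m)) a b c _ ∣V∣≡2^k =
  mk⇔ (rainbow⇒parities m a b c ∣V∣≡2^k) (parities⇒rainbow m a b c ∣V∣≡2^k)
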